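{- Suppose $A$ is finite and let $a\in A$. The formula $$\chi_{\mathsf{D4}}:=\left(\bigwedge_{b\in A\setminus\{a\}}(\Box_bp\wedge C\Box_bp\wedge\Box_b\Box_ap\wedge C\Box_b\Box_ap)\wedge\Box_ap\right)\to Cp$$ belongs to $\mathsf{CKD4}\cap\mathcal{C}_{alt}$ but not to $\mathsf{CKD}\cap\mathcal{C}_{alt}$; in particular $\mathsf{CKD4}\cap\mathcal{C}_{alt}\not\subseteq\mathsf{CKD}\cap\mathcal{C}_{alt}$.
   Context: Fix a set $A$ of agents with $|A|\ge 2$ and a countably infinite set $\mathsf{Prop}$. $\mathcal{L}$: $\varphi::=p\mid\neg\varphi\mid(\varphi\wedge\varphi)\mid\Box_a\varphi$. $\mathcal{C}$ extends this grammar with $C\varphi$ and $E\varphi$. On a Kripke model $\mathcal{M}=\langle W,\{R_a\}_{a\in A},V\rangle$: $\mathcal{M},u\models E\varphi$ iff $\varphi$ holds at every $v$ with $u(\bigcup_aR_a)v$; $\mathcal{M},u\models C\varphi$ iff $\varphi$ holds at every $v$ with $u(\bigcup_aR_a)^+v$ (transitive closure). For $\mathsf{L}\subseteq\mathcal{L}$, $\mathsf{CL}$ is the set of $\mathcal{C}$-formulas valid on all frames that validate $\mathsf{L}$. $\mathsf{KD}$ is the multi-agent normal modal logic $\mathsf{K}$ plus $\Box_a\varphi\to\neg\Box_a\neg\varphi$ for every $a$ (frames: all $R_a$ serial); $\mathsf{KD4}$ adds $\Box_a\varphi\to\Box_a\Box_a\varphi$ for every $a$ (frames: all $R_a$ serial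 and transitive). The fragments $\mathcal{C}_{ -a}$ ($a\in A$) are defined by simultaneous induction: $\mathcal{C}_{ -a}$ is the least set containing every $p\in\mathsf{Prop}$, every $\Box_x\psi$ with $x\in A\setminus\{a\}$ and $\psi\in\mathcal{C}_{ -x}$, and closed under $\neg$, $\wedge$ and $C$. $\mathcal{C}_{alt}$ is the least set containing $\mathsf{Prop}\cup\bigcup_{a\in A}\mathcal{C}_{ -a}$ and closed under $\neg$, $\wedge$ and $C$. -}

module Defs where

open import Data.Nat using (ℕ)
open import Data.Fin using (Fin)
open import Data.List using (List; []; _∷_; filter)
open import Data.List using (allFin) public
open import Data.Product using (Σ; _×_; ∃)
open import Data.Empty using (⊥)
open import Relation.Nullary using (¬_)
open import Relation.Nullary.Decidable using (¬?)
open import Relation.Binary.PropositionalEquality using (_≡_; _≢_)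
open import Relation.Binary using (Rel; Transitive)
open import Relation.Binary.Construct.Closure.Transitive using (TransClosure)
open import Data.Fin using (_≟_)

data Form (n : ℕ) : Set where
  var  : ℕ → Form n
  neg  : Form n → Form n
  _∧'_ : Form n → Form n → Form n
  box  : Fin n → Form n → Form n
  Cf   : Form n → Form n
  Ef   : Form n → Form n

_⇒_ : ∀ {n} → Form n → Form n → Form n
φ ⇒ ψ = neg (φ ∧' neg ψ)

top : ∀ {n} → Form n
top = neg (var 0 ∧' neg (var 0))

bigAnd : ∀ {n} → List (Form n) → Form n
bigAnd []       = top
bigAnd (φ ∷ φs) = φ ∧' bigAnd φs

record Frame (n : ℕ) : Set₁ where
  field
    W : Set
    R : Fin n → Rel W _

record Model (n : ℕ) : Set₁ where
  field
    frame : Frame n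
  open Frame frame public
  field
    V : ℕ → W → Set

module _ {n : ℕ} (M : Model n) where
  open Model M

  Rall : Rel W _
  Rall u v = Σ (Fin n) λ b → R b u v

  sat : W → Form n → Set
  sat u (var p)   = V p u
  sat u (neg φ)   = ¬ sat u φ
  sat u (φ ∧' ψ)  = sat u φ × sat u ψ
  sat u (box b φ) = ∀ v → R b u v → sat v φ
  sat u (Ef φ)    = ∀ v → Rall u v → sat v φ
  sat u (Cf φ)    = ∀ v → TransClosure Rall u v → sat v φ

ValidOn : ∀ {n} → Frame n → Form n → Set₁
ValidOn {n} F φ = (V : ℕ → Frame.W F → Set) → ∀ u →
  sat (record { frame = F ; V = V }) u φ

Serial : ∀ {n} → Frame n → Set
Serial {n} F = (a : Fin n) → ∀ u → ∃ λ v → Frame.R F a u v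

TransitiveFrame : ∀ {n} → Frame n → Set
TransitiveFrame {n} F = (a : Fin n) → Transitive (Frame.R F a)

CKD : ∀ {n} → Form n → Set₁
CKD {n} φ = (F : Frame n) → Serial F → ValidOn F φ

CKD4 : ∀ {n} → Form n → Set₁
CKD4 {n} φ = (F : Frame n) → Serial F → TransitiveFrame F → ValidOn F φ

data Cminus {n : ℕ} (a : Fin n) : Form n → Set where
  var : ∀ p → Cminus a (var p)
  box : ∀ x ψ → x ≢ a → Cminus x ψ → Cminus a (box x ψ)
  neg : ∀ φ → Cminus a φ → Cminus a (neg φ)
  and : ∀ φ ψ → Cminus a φ → Cminus a ψ → Cminus a (φ ∧' ψ)
  C   : ∀ φ → Cminus a φ → Cminus a (Cf φ)

data Calt {n : ℕ} : Form n → Set where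
  var   : ∀ p → Calt (var p)
  minus : ∀ a φ → Cminus a φ → Calt φ
  neg   : ∀ φ → Calt φ → Calt (neg φ)
  and   : ∀ φ ψ → Calt φ → Calt ψ → Calt (φ ∧' ψ)
  C     : ∀ φ → Calt φ → Calt (Cf φ)

others : ∀ {n} → Fin n → List (Fin n)
others a = filter (λ b → ¬? (b ≟ a)) (allFin _)

conjunct : ∀ {n} → Fin n → ℕ → Fin n → Form n
conjunct a p b =
  box b (var p) ∧' (Cf (box b (var p)) ∧' (box b (box a (var p)) ∧' Cf (box b (box a (var p)))))

chiD4 : ∀ {n} → Fin n → ℕ → Form n
chiD4 a p = (bigAnd (Data.List.map (conjunct a p) (others a)) ∧' box a (var p)) ⇒ Cf (var p)

-- On a frame where R_a is transitive, the antecedent of χ_D4 at u makes u and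
-- every world y reachable from it satisfy □_b p and □_b □_a p for all b ≠ a.
-- Hence, if y satisfies □_a p, so does each successor of y: along a b-edge by
-- □_b □_a p, along an a-edge by transitivity. Since □_a p holds at u, induction
-- along the path shows that every step lands in p, which is C p.
-- Transitivity is indispensable: three worlds w₀ →ₐ w₁ →ₐ w₂ (with an a-loop at
-- w₂ and every other agent pointing to w₀) form a serial frame on which χ_D4
-- fails at w₀, as p fails only at w₂. The formula lies in 𝒞_alt because its
-- conjunction over b ≠ a is in 𝒞_{-a} and □_a p is in 𝒞_{-x} for any x ≠ a.
module Submission where

open import Defs
open import Data.Nat using (ℕ; _≤_; s≤s)
open import Data.Fin using (Fin; zero; suc; _≟_)
open import Data.Product using (_×_; _,_; proj₁; proj₂; ∃)
open import Data.Sum using (_⊎_; inj₁; inj₂)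
open import Data.Unit using (⊤; tt)
open import Data.Empty using (⊥; ⊥-elim)
open import Data.List using (List; []; _∷_; map)
open import Data.List.Membership.Propositional using (_∈_)
open import Data.List.Membership.Propositional.Properties using (∈-filter⁺; ∈-filter⁻; ∈-allFin)
open import Data.List.Relation.Unary.All as All using (All; []; _∷_)
open import Data.List.Relation.Unary.All.Properties using (map⁺; map⁻)
open import Relation.Nullary using (¬_; yes; no)
open import Relation.Nullary.Decidable using (¬?)
open import Relation.Binary.PropositionalEquality using (_≡_; _≢_; refl; sym)
open import Relation.Binary using (Transitive)
open import Relation.Binary.Construct.Closure.Transitive using (TransClosure; [_]; _∷_; _∷ʳ_)

∈-others⁺ : ∀ {n} {a b : Fin n} → b ≢ a → b ∈ others a
∈-others⁺ {a = a} {b} b≢a = ∈-filter⁺ (λ c → ¬? (c ≟ a)) (∈-allFin b) b≢a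

∈-others⁻ : ∀ {n} {a b : Fin n} → b ∈ others a → b ≢ a
∈-others⁻ {a = a} b∈ = proj₂ (∈-filter⁻ (λ c → ¬? (c ≟ a)) {xs = allFin _} b∈)

All-others : ∀ {n} {a : Fin n} {P : Fin n → Set} →
  (∀ {b} → b ≢ a → P b) → All P (others a)
All-others Pb = All.tabulate (λ b∈ → Pb (∈-others⁻ b∈))

∃-≢ : ∀ {n} → 2 ≤ n → (a : Fin n) → ∃ λ x → x ≢ a
∃-≢ {ℕ.suc (ℕ.suc _)} _ zero    = suc zero , λ ()
∃-≢ {ℕ.suc (ℕ.suc _)} _ (suc _) = zero , λ ()
∃-≢ {ℕ.suc ℕ.zero} (s≤s ()) zero

module _ {n : ℕ} (M : Model n) where
  open Model M hiding (V)

  sat-bigAnd⁻ : ∀ {u} (φs : List (Form n)) → sat M u (bigAnd φs) → All (sat M u) φs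
  sat-bigAnd⁻ []       _        = []
  sat-bigAnd⁻ (φ ∷ φs) (φ✓ , ✓) = φ✓ ∷ sat-bigAnd⁻ φs ✓

  sat-bigAnd⁺ : ∀ {u} {φs : List (Form n)} → All (sat M u) φs → sat M u (bigAnd φs)
  sat-bigAnd⁺ []          (p✓ , p✗) = p✗ p✓
  sat-bigAnd⁺ (φ✓ ∷ φs✓)            = φ✓ , sat-bigAnd⁺ φs✓

module Soundness {n : ℕ} (F : Frame n) (a : Fin n) (transₐ : Transitive (Frame.R F a))
                 (p : ℕ) (V : ℕ → Frame.W F → Set) where
  M : Model n
  M = record { frame = F ; V = V }
  open Model M hiding (V)

  _⁺_ : W → W → Set
  _⁺_ = TransClosure (Rall M)

  Guarded : W → Set
  Guarded x = ∀ {b} → b ≢ a → sat M x (box b (var p)) × sat M x (box b (box a (var p)))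

  □ₐp-step : ∀ {x y c} → Guarded x → sat M x (box a (var p)) → R c x y →
             V p y × sat M y (box a (var p))
  □ₐp-step {c = c} guarded □ₐp r with c ≟ a
  ... | yes refl = □ₐp _ r , λ z r′ → □ₐp z (transₐ r r′)
  ... | no  c≢a  = proj₁ (guarded c≢a) _ r , proj₂ (guarded c≢a) _ r

  module _ {u : W} (guarded : ∀ {y} → u ≡ y ⊎ u ⁺ y → Guarded y) where

    p-along : ∀ {x v} → u ≡ x ⊎ u ⁺ x → sat M x (box a (var p)) → x ⁺ v → V p v
    p-along reach □ₐp [ _ , r ] = proj₁ (□ₐp-step (guarded reach) □ₐp r)
    p-along reach □ₐp ((c , r) ∷ path) =
      p-along (inj₂ (extend reach)) (proj₂ (□ₐp-step (guarded reach) □ₐp r)) path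
      where
      extend : u ≡ _ ⊎ u ⁺ _ → u ⁺ _
      extend (inj₁ refl) = [ c , r ]
      extend (inj₂ u⁺x)  = u⁺x ∷ʳ (c , r)

  chiD4-holds : ∀ u → sat M u (chiD4 a p)
  chiD4-holds u ((conjuncts , □ₐp) , ¬Cp) = ¬Cp λ v → p-along guarded (inj₁ refl) □ₐp
    where
    conjunct✓ : ∀ {b} → b ≢ a → sat M u (conjunct a p b)
    conjunct✓ b≢a = All.lookup (map⁻ (sat-bigAnd⁻ M _ conjuncts)) (∈-others⁺ b≢a)

    guarded : ∀ {y} → u ≡ y ⊎ u ⁺ y → Guarded y
    guarded (inj₁ refl) b≢a = let (□bp , _ , □b□ₐp , _) = conjunct✓ b≢a in □bp , □b□ₐp
    guarded (inj₂ u⁺y)  b≢a = let (_ , C□bp , _ , C□b□ₐp) = conjunct✓ b≢a in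
                              C□bp _ u⁺y , C□b□ₐp _ u⁺y

chiD4-CKD4 : ∀ {n} (a : Fin n) (p : ℕ) → CKD4 (chiD4 a p)
chiD4-CKD4 a p F _ trans V = Soundness.chiD4-holds F a (trans a) p V

module _ {n : ℕ} {a : Fin n} where

  Cminus-bigAnd : ∀ {φs : List (Form n)} → All (Cminus a) φs → Cminus a (bigAnd φs)
  Cminus-bigAnd []         = neg _ (and _ _ (var 0) (neg _ (var 0)))
  Cminus-bigAnd (φ∈ ∷ φs∈) = and _ _ φ∈ (Cminus-bigAnd φs∈)

  Cminus-conjunct : ∀ {b} (p : ℕ) → b ≢ a → Cminus a (conjunct a p b)
  Cminus-conjunct {b} p b≢a = and _ _ □bp (and _ _ (C _ □bp) (and _ _ □b□ₐp (C _ □b□ₐp)))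
    where
    □bp : Cminus a (box b (var p))
    □bp = box b (var p) b≢a (var p)

    □b□ₐp : Cminus a (box b (box a (var p)))
    □b□ₐp = box b (box a (var p)) b≢a (box a (var p) (λ a≡b → b≢a (sym a≡b)) (var p))

chiD4-Calt : ∀ {n} → 2 ≤ n → (a : Fin n) (p : ℕ) → Calt (chiD4 a p)
chiD4-Calt 2≤n a p with ∃-≢ 2≤n a
... | x , x≢a =
  neg _ (and _ _
    (and _ _ (minus a _ (Cminus-bigAnd (map⁺ (All-others (Cminus-conjunct p)))))
             (minus x _ (box a (var p) (λ a≡x → x≢a (sym a≡x)) (var p))))
    (neg _ (C _ (var p))))

data World : Set where
  w₀ w₁ w₂ : World

data _→ₐ_ : World → World → Set where
  w₀→w₁ : w₀ →ₐ w₁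
  w₁→w₂ : w₁ →ₐ w₂
  w₂→w₂ : w₂ →ₐ w₂

Holds : World → Set
Holds w₀ = ⊤
Holds w₁ = ⊤
Holds w₂ = ⊥

module Countermodel {n : ℕ} (a : Fin n) (p : ℕ) where
  R : Fin n → World → World → Set
  R c x y = (c ≡ a × x →ₐ y) ⊎ (c ≢ a × y ≡ w₀)

  F : Frame n
  F = record { W = World ; R = R }

  serial : Serial F
  serial c x with c ≟ a
  serial c x  | no  c≢a = w₀ , inj₂ (c≢a , refl)
  serial c w₀ | yes c≡a = w₁ , inj₁ (c≡a , w₀→w₁)
  serial c w₁ | yes c≡a = w₂ , inj₁ (c≡a , w₁→w₂)
  serial c w₂ | yes c≡a = w₂ , inj₁ (c≡a , w₂→w₂)

  M : Model n
  M = record { frame = F ; V = λ _ → Holds }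

  □ₐp-w₀ : sat M w₀ (box a (var p))
  □ₐp-w₀ _ (inj₁ (_ , w₀→w₁)) = tt
  □ₐp-w₀ _ (inj₂ (a≢a , _))   = ⊥-elim (a≢a refl)

  □bp : ∀ {b x} → b ≢ a → sat M x (box b (var p))
  □bp b≢a _ (inj₁ (b≡a , _))  = ⊥-elim (b≢a b≡a)
  □bp b≢a _ (inj₂ (_ , refl)) = tt

  □b□ₐp : ∀ {b x} → b ≢ a → sat M x (box b (box a (var p)))
  □b□ₐp b≢a _ (inj₁ (b≡a , _))  = ⊥-elim (b≢a b≡a)
  □b□ₐp b≢a _ (inj₂ (_ , refl))  = □ₐp-w₀

  chiD4-fails : ¬ sat M w₀ (chiD4 a p)
  chiD4-fails chiD4✓ = chiD4✓ ((conjuncts , □ₐp-w₀) , λ Cp → Cp w₂ w₀⁺w₂)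
    where
    conjuncts : sat M w₀ (bigAnd (map (conjunct a p) (others a)))
    conjuncts = sat-bigAnd⁺ M (map⁺ (All-others λ b≢a →
      □bp b≢a , (λ _ _ → □bp b≢a) , □b□ₐp b≢a , (λ _ _ → □b□ₐp b≢a)))

    w₀⁺w₂ : TransClosure (Rall M) w₀ w₂
    w₀⁺w₂ = (a , inj₁ (refl , w₀→w₁)) ∷ [ a , inj₁ (refl , w₁→w₂) ]

chiD4-¬CKD : ∀ {n} (a : Fin n) (p : ℕ) → ¬ CKD (chiD4 a p)
chiD4-¬CKD a p valid = chiD4-fails (valid F serial (λ _ → Holds) w₀)
  where open Countermodel a p using (F; serial; chiD4-fails)

mainTheorem14 : (n : ℕ) → 2 ≤ n → (a : Fin n) → (p : ℕ) →
    (CKD4 (chiD4 a p) × Calt (chiD4 a p))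
    × ¬ (CKD (chiD4 a p) × Calt (chiD4 a p))
    × ¬ ((φ : Form n) → CKD4 φ × Calt φ → CKD φ × Calt φ)
mainTheorem14 n 2≤n a p =
  χ∈CKD4∩Calt , (λ χ∈ → χ∉CKD (proj₁ χ∈)) , (λ ⊆ → χ∉CKD (proj₁ (⊆ _ χ∈CKD4∩Calt)))
  where
  χ∈CKD4∩Calt : CKD4 (chiD4 a p) × Calt (chiD4 a p)
  χ∈CKD4∩Calt = chiD4-CKD4 a p , chiD4-Calt 2≤n a p

  χ∉CKD : ¬ CKD (chiD4 a p)
  χ∉CKD = chiD4-¬CKD a p
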